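{- Let $m$ be a positive integer, $s=(-1)^m$, $S$ the $s$-symmetrization operator, and let $f,g$ be LPs of lengths $n$ and $\delta$ such that $S(f)\in\mathcal{P}(2n,m)$ and $S(f\lor g)\in\mathcal{P}(2n+2\delta,m)$. For $j\ge 0$ define $G_j=h_1\lor h_2\lor\cdots\lor h_j$ (with $f\lor G_0=f$), where $h_i=g$ if $i$ is odd and $h_i=s\,g^*$ if $i$ is even. Then for every $j\ge 0$, $S(f\lor G_j)\in\mathcal{P}(2n+2j\delta,m)$ and $S(f\lor G_j)$ is $(-1)^m$-symmetric.
   Context: A Littlewood polynomial (LP) of length $n$ is a polynomial $f(x)=\sum_{i=0}^{n-1}a_ix^i$ with every $a_i\in\{1,-1\}$; its length is denoted $\ell(f)=n$. An LP has order $m$ if $(x-1)^m$ divides it; $\mathcal{P}(n,m)$ is the set of LPs of length $n$ and order $m$. The join of LPs is $(f\lor g)(x)=f(x)+x^{\ell(f)}g(x)$ (associative). The reversal of an LP $f$ is $f^*(x)=x^{\ell(f)-1}f(1/x)$. For $s\in\{1,-1\}$, the $s$-symmetrization of $f$ is $S(f)=f\lor(s f^*)$. An LP $h$ is $(-1)^m$-symmetric if $h^*=(-1)^m h$. -}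

module Defs where

open import Data.Nat using (ℕ; zero; suc)
open import Data.Integer using (ℤ; +_; -_; _+_; _*_)
open import Data.List using (List; []; _∷_; _++_; reverse; map; length)
open import Data.List.Relation.Unary.All using (All)
open import Data.Product using (Σ; _×_)
open import Data.Sum using (_⊎_)
open import Relation.Binary.PropositionalEquality using (_≡_)

-- Polynomials over ℤ as coefficient lists, lowest degree first.
Poly : Set
Poly = List ℤ

coeff : Poly → ℕ → ℤ
coeff []       _       = + 0
coeff (a ∷ p)  zero    = a
coeff (a ∷ p)  (suc i) = coeff p i

-- polynomial equality (ignores trailing zeros)
_≈ₚ_ : Poly → Poly → Set
p ≈ₚ q = ∀ i → coeff p i ≡ coeff q i

_+ₚ_ : Poly → Poly → Poly
[]      +ₚ q       = q
(a ∷ p) +ₚ []      = a ∷ p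
(a ∷ p) +ₚ (b ∷ q) = (a + b) ∷ (p +ₚ q)

scaleₚ : ℤ → Poly → Poly
scaleₚ c p = map (c *_) p

_*ₚ_ : Poly → Poly → Poly
[]      *ₚ q = []
(a ∷ p) *ₚ q = scaleₚ a q +ₚ (+ 0 ∷ (p *ₚ q))

x-1 : Poly
x-1 = - (+ 1) ∷ + 1 ∷ []

x-1^ : ℕ → Poly
x-1^ zero    = + 1 ∷ []
x-1^ (suc m) = x-1 *ₚ x-1^ m

_∣ₚ_ : Poly → Poly → Set
d ∣ₚ f = Σ Poly (λ q → (d *ₚ q) ≈ₚ f)

IsLP : Poly → Set
IsLP f = All (λ a → a ≡ + 1 ⊎ a ≡ - (+ 1)) f

ℓ : Poly → ℕ
ℓ = length

HasOrder : Poly → ℕ → Set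
HasOrder f m = x-1^ m ∣ₚ f

InP : Poly → ℕ → ℕ → Set
InP f n m = IsLP f × ℓ f ≡ n × HasOrder f m

-- join f ∨ g = f(x) + x^{ℓ(f)} g(x): on coefficient lists this is concatenation
_∨_ : Poly → Poly → Poly
f ∨ g = f ++ g

-- reversal f*(x) = x^{ℓ(f)-1} f(1/x)
_* : Poly → Poly
f * = reverse f

sgn : ℕ → ℤ
sgn zero    = + 1
sgn (suc m) = - sgn m

Sym : ℤ → Poly → Poly
Sym s f = f ∨ scaleₚ s (f *)

IsSymmetric : ℤ → Poly → Set
IsSymmetric s h = h * ≡ scaleₚ s h

-- h_i = g (i odd), s g* (i even), for i ≥ 1
hSeq : ℤ → Poly → ℕ → Poly
hSeq s g zero          = scaleₚ s (g *)
hSeq s g (suc zero)    = g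
hSeq s g (suc (suc i)) = hSeq s g i

GSeq : ℤ → Poly → ℕ → Poly
GSeq s g zero    = []
GSeq s g (suc j) = GSeq s g j ∨ hSeq s g (suc j)

{-# OPTIONS --safe #-}
module Submission where

-- Write P = g ∨ s g* and Pʲ for the j-fold join of P. Since (s g*)* = s g,
-- the blocks of s G_j* continue the alternating pattern of G_j, so
-- G_j ∨ s G_j* = Pʲ and S(f ∨ G_j) = f ∨ Pʲ ∨ s f*. Concatenation is
-- linear up to shifts: with A = f, B = s f* and Q = Pʲ,
--   A ∨ Q ∨ P ∨ B = A ∨ Q ∨ B + x^ℓ(Q) (A ∨ P ∨ B − A ∨ B),
-- so divisibility by (x − 1)^m propagates from S(f) = A ∨ B and
-- S(f ∨ g) = A ∨ P ∨ B to every j. Symmetry and the Littlewood property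
-- only concern the list of coefficients.

open import Defs
open import Data.Nat using (ℕ; zero; suc; _+_; _*_; _≥_)
import Data.Nat.Properties as ℕ
open import Data.Nat.Tactic.RingSolver as ℕ-Solver using ()
open import Data.Integer using (ℤ; +_; -_; -1ℤ)
  renaming (_+_ to _+ᶻ_; _*_ to _*ᶻ_)
import Data.Integer.Properties as ℤ
open import Data.Integer.Tactic.RingSolver using (solve-∀)
open import Data.List using ([]; _∷_; _++_; reverse; map; length; replicate)
open import Data.List.Properties
  using (++-assoc; ++-identityʳ; length-++; length-map; length-reverse; length-replicate;
         map-++; map-∘; map-cong; map-id; reverse-++; reverse-map; reverse-involutive)
open import Data.List.Relation.Unary.All as All using (All)
open import Data.List.Relation.Unary.All.Properties using (++⁺; map⁺)
open import Data.List.Relation.Binary.Permutation.Propositional using (↭-sym)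
open import Data.List.Relation.Binary.Permutation.Propositional.Properties
  using (All-resp-↭; ↭-reverse)
open import Data.Product using (_×_; _,_)
open import Data.Sum using (_⊎_; inj₁; inj₂)
open import Relation.Binary.PropositionalEquality
  using (_≡_; refl; sym; trans; cong; cong₂; subst; module ≡-Reasoning)
open ≡-Reasoning

coeff-+ₚ : ∀ p q i → coeff (p +ₚ q) i ≡ coeff p i +ᶻ coeff q i
coeff-+ₚ []      q       i       = sym (ℤ.+-identityˡ _)
coeff-+ₚ (a ∷ p) []      i       = sym (ℤ.+-identityʳ _)
coeff-+ₚ (a ∷ p) (b ∷ q) zero    = refl
coeff-+ₚ (a ∷ p) (b ∷ q) (suc i) = coeff-+ₚ p q i

coeff-scaleₚ : ∀ c p i → coeff (scaleₚ c p) i ≡ c *ᶻ coeff p i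
coeff-scaleₚ c []      i       = sym (ℤ.*-zeroʳ c)
coeff-scaleₚ c (a ∷ p) zero    = refl
coeff-scaleₚ c (a ∷ p) (suc i) = coeff-scaleₚ c p i

coeff-*ₚ-∷ : ∀ a p q i →
  coeff ((a ∷ p) *ₚ q) i ≡ a *ᶻ coeff q i +ᶻ coeff (+ 0 ∷ (p *ₚ q)) i
coeff-*ₚ-∷ a p q i =
  trans (coeff-+ₚ (scaleₚ a q) _ i) (cong (_+ᶻ _) (coeff-scaleₚ a q i))

∷-cong : ∀ a {p q} → p ≈ₚ q → (a ∷ p) ≈ₚ (a ∷ q)
∷-cong a p≈q zero    = refl
∷-cong a p≈q (suc i) = p≈q i

*ₚ-distribˡ-+ₚ : ∀ p q r → (p *ₚ (q +ₚ r)) ≈ₚ ((p *ₚ q) +ₚ (p *ₚ r))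
*ₚ-distribˡ-+ₚ []      q r i = refl
*ₚ-distribˡ-+ₚ (a ∷ p) q r i = begin
  coeff ((a ∷ p) *ₚ (q +ₚ r)) i
    ≡⟨ coeff-*ₚ-∷ a p (q +ₚ r) i ⟩
  a *ᶻ coeff (q +ₚ r) i +ᶻ coeff (+ 0 ∷ (p *ₚ (q +ₚ r))) i
    ≡⟨ cong₂ (λ x y → a *ᶻ x +ᶻ y) (coeff-+ₚ q r i)
             (trans (∷-cong (+ 0) (*ₚ-distribˡ-+ₚ p q r) i) (coeff-+ₚ (+ 0 ∷ pq) (+ 0 ∷ pr) i)) ⟩
  a *ᶻ (coeff q i +ᶻ coeff r i) +ᶻ (coeff (+ 0 ∷ pq) i +ᶻ coeff (+ 0 ∷ pr) i)
    ≡⟨ interchange a _ _ _ _ ⟩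
  (a *ᶻ coeff q i +ᶻ coeff (+ 0 ∷ pq) i) +ᶻ (a *ᶻ coeff r i +ᶻ coeff (+ 0 ∷ pr) i)
    ≡⟨ sym (cong₂ _+ᶻ_ (coeff-*ₚ-∷ a p q i) (coeff-*ₚ-∷ a p r i)) ⟩
  coeff ((a ∷ p) *ₚ q) i +ᶻ coeff ((a ∷ p) *ₚ r) i
    ≡⟨ sym (coeff-+ₚ ((a ∷ p) *ₚ q) _ i) ⟩
  coeff (((a ∷ p) *ₚ q) +ₚ ((a ∷ p) *ₚ r)) i ∎
  where
  pq = p *ₚ q
  pr = p *ₚ r
  interchange : ∀ a x y u v → a *ᶻ (x +ᶻ y) +ᶻ (u +ᶻ v) ≡ (a *ᶻ x +ᶻ u) +ᶻ (a *ᶻ y +ᶻ v)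
  interchange = solve-∀

*ₚ-scaleₚ : ∀ p c q → (p *ₚ scaleₚ c q) ≈ₚ scaleₚ c (p *ₚ q)
*ₚ-scaleₚ []      c q i = refl
*ₚ-scaleₚ (a ∷ p) c q i = begin
  coeff ((a ∷ p) *ₚ scaleₚ c q) i
    ≡⟨ coeff-*ₚ-∷ a p (scaleₚ c q) i ⟩
  a *ᶻ coeff (scaleₚ c q) i +ᶻ coeff (+ 0 ∷ (p *ₚ scaleₚ c q)) i
    ≡⟨ cong₂ (λ x y → a *ᶻ x +ᶻ y) (coeff-scaleₚ c q i) (tail i) ⟩
  a *ᶻ (c *ᶻ coeff q i) +ᶻ c *ᶻ coeff (+ 0 ∷ (p *ₚ q)) i
    ≡⟨ factor a c _ _ ⟩
  c *ᶻ (a *ᶻ coeff q i +ᶻ coeff (+ 0 ∷ (p *ₚ q)) i)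
    ≡⟨ cong (c *ᶻ_) (sym (coeff-*ₚ-∷ a p q i)) ⟩
  c *ᶻ coeff ((a ∷ p) *ₚ q) i
    ≡⟨ sym (coeff-scaleₚ c ((a ∷ p) *ₚ q) i) ⟩
  coeff (scaleₚ c ((a ∷ p) *ₚ q)) i ∎
  where
  tail : ∀ i → coeff (+ 0 ∷ (p *ₚ scaleₚ c q)) i ≡ c *ᶻ coeff (+ 0 ∷ (p *ₚ q)) i
  tail zero    = sym (ℤ.*-zeroʳ c)
  tail (suc i) = trans (*ₚ-scaleₚ p c q i) (coeff-scaleₚ c (p *ₚ q) i)
  factor : ∀ a c x u → a *ᶻ (c *ᶻ x) +ᶻ c *ᶻ u ≡ c *ᶻ (a *ᶻ x +ᶻ u)
  factor = solve-∀

*ₚ-x : ∀ p q → (p *ₚ (+ 0 ∷ q)) ≈ₚ (+ 0 ∷ (p *ₚ q))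
*ₚ-x []      q zero    = refl
*ₚ-x []      q (suc i) = refl
*ₚ-x (a ∷ p) q zero    = begin
  coeff ((a ∷ p) *ₚ (+ 0 ∷ q)) zero ≡⟨ coeff-*ₚ-∷ a p (+ 0 ∷ q) zero ⟩
  a *ᶻ + 0 +ᶻ + 0                   ≡⟨ cong (_+ᶻ + 0) (ℤ.*-zeroʳ a) ⟩
  + 0                               ∎
*ₚ-x (a ∷ p) q (suc i) = begin
  coeff ((a ∷ p) *ₚ (+ 0 ∷ q)) (suc i)         ≡⟨ coeff-*ₚ-∷ a p (+ 0 ∷ q) (suc i) ⟩
  a *ᶻ coeff q i +ᶻ coeff (p *ₚ (+ 0 ∷ q)) i   ≡⟨ cong (a *ᶻ coeff q i +ᶻ_) (*ₚ-x p q i) ⟩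
  a *ᶻ coeff q i +ᶻ coeff (+ 0 ∷ (p *ₚ q)) i   ≡⟨ sym (coeff-*ₚ-∷ a p q i) ⟩
  coeff ((a ∷ p) *ₚ q) i                       ∎

shift : ℕ → Poly → Poly
shift k q = replicate k (+ 0) ++ q

shift-cong : ∀ k {p q} → p ≈ₚ q → shift k p ≈ₚ shift k q
shift-cong zero    p≈q = p≈q
shift-cong (suc k) p≈q = ∷-cong (+ 0) (shift-cong k p≈q)

*ₚ-shift : ∀ p k q → (p *ₚ shift k q) ≈ₚ shift k (p *ₚ q)
*ₚ-shift p zero    q i       = refl
*ₚ-shift p (suc k) q zero    = *ₚ-x p (shift k q) zero
*ₚ-shift p (suc k) q (suc i) = trans (*ₚ-x p (shift k q) (suc i)) (*ₚ-shift p k q i)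

length-shift : ∀ k xs → length (shift k xs) ≡ k + length xs
length-shift k xs = trans (length-++ (replicate k (+ 0))) (cong (_+ length xs) (length-replicate k))

coeff-shift-∨ : ∀ k xs ys i →
  coeff (shift k (xs ∨ ys)) i ≡ coeff (shift k xs) i +ᶻ coeff (shift (k + length xs) ys) i
coeff-shift-∨ k xs ys i = begin
  coeff (shift k (xs ++ ys)) i
    ≡⟨ cong (λ z → coeff z i) (sym (++-assoc (replicate k (+ 0)) xs ys)) ⟩
  coeff (shift k xs ++ ys) i
    ≡⟨ split (shift k xs) ys i ⟩
  coeff (shift k xs) i +ᶻ coeff (shift (length (shift k xs)) ys) i
    ≡⟨ cong (λ n → coeff (shift k xs) i +ᶻ coeff (shift n ys) i) (length-shift k xs) ⟩
  coeff (shift k xs) i +ᶻ coeff (shift (k + length xs) ys) i ∎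
  where
  split : ∀ us ys i → coeff (us ++ ys) i ≡ coeff us i +ᶻ coeff (shift (length us) ys) i
  split []       ys i       = sym (ℤ.+-identityˡ _)
  split (a ∷ us) ys zero    = sym (ℤ.+-identityʳ a)
  split (a ∷ us) ys (suc i) = split us ys i

coeff-shift-∨₃ : ∀ k xs ys zs i →
  coeff (shift k (xs ∨ (ys ∨ zs))) i ≡
  coeff (shift k xs) i +ᶻ (coeff (shift (k + length xs) ys) i
                         +ᶻ coeff (shift (k + length xs + length ys) zs) i)
coeff-shift-∨₃ k xs ys zs i =
  trans (coeff-shift-∨ k xs (ys ∨ zs) i)
        (cong (coeff (shift k xs) i +ᶻ_) (coeff-shift-∨ (k + length xs) ys zs i))

module _ (d : Poly) where

  ∣ₚ-resp-≈ₚ : ∀ p q → d ∣ₚ p → p ≈ₚ q → d ∣ₚ q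
  ∣ₚ-resp-≈ₚ p q (a , da≈p) p≈q = a , λ i → trans (da≈p i) (p≈q i)

  ∣ₚ-+ₚ : ∀ p q → d ∣ₚ p → d ∣ₚ q → d ∣ₚ (p +ₚ q)
  ∣ₚ-+ₚ p q (a , da≈p) (b , db≈q) = a +ₚ b , λ i → begin
    coeff (d *ₚ (a +ₚ b)) i              ≡⟨ *ₚ-distribˡ-+ₚ d a b i ⟩
    coeff ((d *ₚ a) +ₚ (d *ₚ b)) i       ≡⟨ coeff-+ₚ (d *ₚ a) _ i ⟩
    coeff (d *ₚ a) i +ᶻ coeff (d *ₚ b) i ≡⟨ cong₂ _+ᶻ_ (da≈p i) (db≈q i) ⟩
    coeff p i +ᶻ coeff q i               ≡⟨ sym (coeff-+ₚ p q i) ⟩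
    coeff (p +ₚ q) i                     ∎

  ∣ₚ-scaleₚ : ∀ c p → d ∣ₚ p → d ∣ₚ scaleₚ c p
  ∣ₚ-scaleₚ c p (a , da≈p) = scaleₚ c a , λ i → begin
    coeff (d *ₚ scaleₚ c a) i   ≡⟨ *ₚ-scaleₚ d c a i ⟩
    coeff (scaleₚ c (d *ₚ a)) i ≡⟨ coeff-scaleₚ c (d *ₚ a) i ⟩
    c *ᶻ coeff (d *ₚ a) i       ≡⟨ cong (c *ᶻ_) (da≈p i) ⟩
    c *ᶻ coeff p i              ≡⟨ sym (coeff-scaleₚ c p i) ⟩
    coeff (scaleₚ c p) i        ∎

  ∣ₚ-shift : ∀ k p → d ∣ₚ p → d ∣ₚ shift k p
  ∣ₚ-shift k p (a , da≈p) = shift k a , λ i → trans (*ₚ-shift d k a i) (shift-cong k da≈p i)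

infixl 30 _∨^_
_∨^_ : Poly → ℕ → Poly
P ∨^ zero  = []
P ∨^ suc j = (P ∨^ j) ∨ P

∨-insert : ∀ A Q P B →
  (A ∨ ((Q ∨ P) ∨ B)) ≈ₚ
  (((A ∨ (Q ∨ B)) +ₚ shift (length Q) (A ∨ (P ∨ B))) +ₚ scaleₚ -1ℤ (shift (length Q) (A ∨ B)))
∨-insert A Q P B i = begin
  coeff (A ∨ ((Q ∨ P) ∨ B)) i
    ≡⟨ cong (λ z → coeff (A ∨ z) i) (++-assoc Q P B) ⟩
  coeff (A ∨ (Q ∨ (P ∨ B))) i
    ≡⟨ trans (coeff-shift-∨₃ 0 A Q (P ∨ B) i)
             (cong (λ z → α +ᶻ (β +ᶻ z)) (coeff-shift-∨ (a + c) P B i)) ⟩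
  α +ᶻ (β +ᶻ (γ +ᶻ ε))
    ≡⟨ telescope α β γ δ ε ζ ⟩
  (α +ᶻ (β +ᶻ δ) +ᶻ (ζ +ᶻ (γ +ᶻ ε))) +ᶻ -1ℤ *ᶻ (ζ +ᶻ δ)
    ≡⟨ sym expand-rhs ⟩
  coeff (((A ∨ (Q ∨ B)) +ₚ shift c (A ∨ (P ∨ B))) +ₚ scaleₚ -1ℤ (shift c (A ∨ B))) i ∎
  where
  a = length A
  c = length Q
  p = length P
  α = coeff A i
  β = coeff (shift a Q) i
  γ = coeff (shift (a + c) P) i
  δ = coeff (shift (a + c) B) i
  ε = coeff (shift (a + c + p) B) i
  ζ = coeff (shift c A) i
  telescope : ∀ α β γ δ ε ζ →
    α +ᶻ (β +ᶻ (γ +ᶻ ε)) ≡ (α +ᶻ (β +ᶻ δ) +ᶻ (ζ +ᶻ (γ +ᶻ ε))) +ᶻ -1ℤ *ᶻ (ζ +ᶻ δ)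
  telescope = solve-∀
  expand-rhs :
    coeff (((A ∨ (Q ∨ B)) +ₚ shift c (A ∨ (P ∨ B))) +ₚ scaleₚ -1ℤ (shift c (A ∨ B))) i ≡
    (α +ᶻ (β +ᶻ δ) +ᶻ (ζ +ᶻ (γ +ᶻ ε))) +ᶻ -1ℤ *ᶻ (ζ +ᶻ δ)
  expand-rhs = begin
    coeff (((A ∨ (Q ∨ B)) +ₚ shift c (A ∨ (P ∨ B))) +ₚ scaleₚ -1ℤ (shift c (A ∨ B))) i
      ≡⟨ coeff-+ₚ ((A ∨ (Q ∨ B)) +ₚ shift c (A ∨ (P ∨ B))) _ i ⟩
    coeff ((A ∨ (Q ∨ B)) +ₚ shift c (A ∨ (P ∨ B))) i +ᶻ coeff (scaleₚ -1ℤ (shift c (A ∨ B))) i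
      ≡⟨ cong₂ _+ᶻ_ (coeff-+ₚ (A ∨ (Q ∨ B)) _ i) (coeff-scaleₚ -1ℤ (shift c (A ∨ B)) i) ⟩
    (coeff (A ∨ (Q ∨ B)) i +ᶻ coeff (shift c (A ∨ (P ∨ B))) i)
      +ᶻ -1ℤ *ᶻ coeff (shift c (A ∨ B)) i
      ≡⟨ cong₂ (λ x y → (x +ᶻ y) +ᶻ -1ℤ *ᶻ coeff (shift c (A ∨ B)) i)
               (coeff-shift-∨₃ 0 A Q B i) (coeff-shift-∨₃ c A P B i) ⟩
    (α +ᶻ (β +ᶻ δ) +ᶻ (ζ +ᶻ (coeff (shift (c + a) P) i +ᶻ coeff (shift (c + a + p) B) i)))
      +ᶻ -1ℤ *ᶻ coeff (shift c (A ∨ B)) i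
      ≡⟨ cong₂ (λ w z → (α +ᶻ (β +ᶻ δ) +ᶻ (ζ +ᶻ (coeff (shift w P) i +ᶻ coeff (shift (w + p) B) i)))
                          +ᶻ -1ℤ *ᶻ z)
               (ℕ.+-comm c a)
               (trans (coeff-shift-∨ c A B i) (cong (λ w → ζ +ᶻ coeff (shift w B) i) (ℕ.+-comm c a))) ⟩
    (α +ᶻ (β +ᶻ δ) +ᶻ (ζ +ᶻ (γ +ᶻ ε))) +ᶻ -1ℤ *ᶻ (ζ +ᶻ δ) ∎

∣ₚ-∨^ : ∀ d A P B → d ∣ₚ (A ∨ B) → d ∣ₚ (A ∨ (P ∨ B)) → ∀ j → d ∣ₚ (A ∨ ((P ∨^ j) ∨ B))
∣ₚ-∨^ d A P B d∣AB d∣APB zero    = d∣AB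
∣ₚ-∨^ d A P B d∣AB d∣APB (suc j) =
  ∣ₚ-resp-≈ₚ d ((T +ₚ U) +ₚ V) (A ∨ ((Q ∨ P) ∨ B))
    (∣ₚ-+ₚ d (T +ₚ U) V
      (∣ₚ-+ₚ d T U (∣ₚ-∨^ d A P B d∣AB d∣APB j) (∣ₚ-shift d c (A ∨ (P ∨ B)) d∣APB))
      (∣ₚ-scaleₚ d -1ℤ (shift c (A ∨ B)) (∣ₚ-shift d c (A ∨ B) d∣AB)))
    (λ i → sym (∨-insert A Q P B i))
  where
  Q = P ∨^ j
  c = length Q
  T = A ∨ (Q ∨ B)
  U = shift c (A ∨ (P ∨ B))
  V = scaleₚ -1ℤ (shift c (A ∨ B))

IsSign : ℤ → Set
IsSign a = a ≡ + 1 ⊎ a ≡ -1ℤ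

sgn-isSign : ∀ m → IsSign (sgn m)
sgn-isSign zero    = inj₁ refl
sgn-isSign (suc m) with sgn-isSign m
... | inj₁ s≡1  = inj₂ (cong -_ s≡1)
... | inj₂ s≡-1 = inj₁ (cong -_ s≡-1)

isSign-* : ∀ {a b} → IsSign a → IsSign b → IsSign (a *ᶻ b)
isSign-* (inj₁ refl) (inj₁ refl) = inj₁ refl
isSign-* (inj₁ refl) (inj₂ refl) = inj₂ refl
isSign-* (inj₂ refl) (inj₁ refl) = inj₂ refl
isSign-* (inj₂ refl) (inj₂ refl) = inj₁ refl

sign-*-involutive : ∀ {s} → IsSign s → ∀ a → s *ᶻ (s *ᶻ a) ≡ a
sign-*-involutive (inj₁ refl) a = trans (ℤ.*-identityˡ _) (ℤ.*-identityˡ a)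
sign-*-involutive (inj₂ refl) a =
  trans (ℤ.-1*i≡-i _) (trans (cong -_ (ℤ.-1*i≡-i a)) (ℤ.neg-involutive a))

signedReverse : ℤ → Poly → Poly
signedReverse s f = scaleₚ s (f *)

signedReverse-∨ : ∀ s xs ys → signedReverse s (xs ∨ ys) ≡ signedReverse s ys ∨ signedReverse s xs
signedReverse-∨ s xs ys = trans (cong (map (s *ᶻ_)) (reverse-++ xs ys)) (map-++ (s *ᶻ_) (reverse ys) (reverse xs))

reverse-signedReverse : ∀ s xs → reverse (signedReverse s xs) ≡ scaleₚ s xs
reverse-signedReverse s xs =
  trans (sym (reverse-map (s *ᶻ_) (reverse xs))) (cong (map (s *ᶻ_)) (reverse-involutive xs))

length-signedReverse : ∀ s xs → length (signedReverse s xs) ≡ length xs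
length-signedReverse s xs = trans (length-map _ (reverse xs)) (length-reverse xs)

length-Sym : ∀ s f → length (Sym s f) ≡ length f + length f
length-Sym s f = trans (length-++ f) (cong (_+_ (length f)) (length-signedReverse s f))

module _ {s : ℤ} (s-sign : IsSign s) where

  scaleₚ-involutive : ∀ xs → scaleₚ s (scaleₚ s xs) ≡ xs
  scaleₚ-involutive xs =
    trans (sym (map-∘ xs)) (trans (map-cong (sign-*-involutive s-sign) xs) (map-id xs))

  signedReverse-involutive : ∀ xs → signedReverse s (signedReverse s xs) ≡ xs
  signedReverse-involutive xs =
    trans (cong (scaleₚ s) (reverse-signedReverse s xs)) (scaleₚ-involutive xs)

  Sym-isSymmetric : ∀ f → IsSymmetric s (Sym s f)
  Sym-isSymmetric f = begin
    reverse (f ∨ signedReverse s f)                 ≡⟨ reverse-++ f (signedReverse s f) ⟩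
    reverse (signedReverse s f) ∨ reverse f         ≡⟨ cong (_∨ reverse f) (reverse-signedReverse s f) ⟩
    scaleₚ s f ∨ reverse f                          ≡⟨ cong (scaleₚ s f ∨_) (sym (scaleₚ-involutive (reverse f))) ⟩
    scaleₚ s f ∨ scaleₚ s (signedReverse s f)       ≡⟨ sym (map-++ (s *ᶻ_) f (signedReverse s f)) ⟩
    scaleₚ s (f ∨ signedReverse s f)                ∎

  IsLP-signedReverse : ∀ {xs} → IsLP xs → IsLP (signedReverse s xs)
  IsLP-signedReverse {xs} xs-LP =
    map⁺ (All.map (isSign-* s-sign) (All-resp-↭ (↭-sym (↭-reverse xs)) xs-LP))

  module _ (g : Poly) where

    period : Poly
    period = g ∨ signedReverse s g

    signedReverse-hSeq : ∀ i → signedReverse s (hSeq s g i) ≡ hSeq s g (suc i)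
    signedReverse-hSeq zero          = signedReverse-involutive g
    signedReverse-hSeq (suc zero)    = refl
    signedReverse-hSeq (suc (suc i)) = signedReverse-hSeq i

    period-slide : ∀ j →
      signedReverse s (GSeq s g j) ∨ period
        ≡ hSeq s g (suc j) ∨ (hSeq s g (suc (suc j)) ∨ signedReverse s (GSeq s g j))
    period-slide zero    = cong (g ∨_) (sym (++-identityʳ (signedReverse s g)))
    period-slide (suc j) = begin
      signedReverse s (GSeq s g (suc j)) ∨ period   ≡⟨ cong (_∨ period) unfold ⟩
      (h₂ ∨ R) ∨ period                             ≡⟨ ++-assoc h₂ R period ⟩
      h₂ ∨ (R ∨ period)                             ≡⟨ cong (h₂ ∨_) (period-slide j) ⟩
      h₂ ∨ (h₁ ∨ (h₂ ∨ R))                          ≡⟨ cong (λ z → h₂ ∨ (h₁ ∨ z)) (sym unfold) ⟩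
      h₂ ∨ (h₁ ∨ signedReverse s (GSeq s g (suc j))) ∎
      where
      h₁ = hSeq s g (suc j)
      h₂ = hSeq s g (suc (suc j))
      R  = signedReverse s (GSeq s g j)
      unfold : signedReverse s (GSeq s g (suc j)) ≡ h₂ ∨ R
      unfold = trans (signedReverse-∨ s (GSeq s g j) h₁) (cong (_∨ R) (signedReverse-hSeq (suc j)))

    GSeq-∨-signedReverse : ∀ j → GSeq s g j ∨ signedReverse s (GSeq s g j) ≡ period ∨^ j
    GSeq-∨-signedReverse zero    = refl
    GSeq-∨-signedReverse (suc j) = begin
      (G ∨ h) ∨ signedReverse s (G ∨ h)                 ≡⟨ cong ((G ∨ h) ∨_) (signedReverse-∨ s G h) ⟩
      (G ∨ h) ∨ (signedReverse s h ∨ R)                 ≡⟨ ++-assoc G h _ ⟩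
      G ∨ (h ∨ (signedReverse s h ∨ R))                 ≡⟨ cong (λ z → G ∨ (h ∨ (z ∨ R))) (signedReverse-hSeq (suc j)) ⟩
      G ∨ (h ∨ (hSeq s g (suc (suc j)) ∨ R))            ≡⟨ cong (G ∨_) (sym (period-slide j)) ⟩
      G ∨ (R ∨ period)                                  ≡⟨ sym (++-assoc G R period) ⟩
      (G ∨ R) ∨ period                                  ≡⟨ cong (_∨ period) (GSeq-∨-signedReverse j) ⟩
      (period ∨^ j) ∨ period                            ∎
      where
      G = GSeq s g j
      h = hSeq s g (suc j)
      R = signedReverse s G

    Sym-∨-GSeq : ∀ f j → Sym s (f ∨ GSeq s g j) ≡ f ∨ ((period ∨^ j) ∨ signedReverse s f)
    Sym-∨-GSeq f j = begin
      (f ∨ G) ∨ signedReverse s (f ∨ G)                  ≡⟨ cong ((f ∨ G) ∨_) (signedReverse-∨ s f G) ⟩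
      (f ∨ G) ∨ (signedReverse s G ∨ signedReverse s f)  ≡⟨ ++-assoc f G _ ⟩
      f ∨ (G ∨ (signedReverse s G ∨ signedReverse s f))  ≡⟨ cong (f ∨_) (sym (++-assoc G (signedReverse s G) _)) ⟩
      f ∨ ((G ∨ signedReverse s G) ∨ signedReverse s f)  ≡⟨ cong (λ z → f ∨ (z ∨ signedReverse s f)) (GSeq-∨-signedReverse j) ⟩
      f ∨ ((period ∨^ j) ∨ signedReverse s f)            ∎
      where
      G = GSeq s g j

    IsLP-GSeq : IsLP g → ∀ j → IsLP (GSeq s g j)
    IsLP-GSeq g-LP zero    = All.[]
    IsLP-GSeq g-LP (suc j) = ++⁺ (IsLP-GSeq g-LP j) (IsLP-hSeq (suc j))
      where
      IsLP-hSeq : ∀ i → IsLP (hSeq s g i)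
      IsLP-hSeq zero          = IsLP-signedReverse g-LP
      IsLP-hSeq (suc zero)    = g-LP
      IsLP-hSeq (suc (suc i)) = IsLP-hSeq i

    length-GSeq : ∀ j → length (GSeq s g j) ≡ j * length g
    length-GSeq zero    = refl
    length-GSeq (suc j) =
      trans (length-++ (GSeq s g j))
            (trans (cong₂ _+_ (length-GSeq j) (length-hSeq (suc j))) (ℕ.+-comm (j * length g) (length g)))
      where
      length-hSeq : ∀ i → length (hSeq s g i) ≡ length g
      length-hSeq zero          = length-signedReverse s g
      length-hSeq (suc zero)    = refl
      length-hSeq (suc (suc i)) = length-hSeq i

corollary6p3 : (m : ℕ) → m ≥ 1 → (f g : Poly) → (n δ : ℕ) →
    IsLP f → ℓ f ≡ n → IsLP g → ℓ g ≡ δ →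
    InP (Sym (sgn m) f) (2 * n) m →
    InP (Sym (sgn m) (f ∨ g)) (2 * n + 2 * δ) m →
    (j : ℕ) →
      InP (Sym (sgn m) (f ∨ GSeq (sgn m) g j)) (2 * n + 2 * j * δ) m
      × IsSymmetric (sgn m) (Sym (sgn m) (f ∨ GSeq (sgn m) g j))
-- The argument works for every m, including m = 0.
corollary6p3 m _ f g .(length f) .(length g) f-LP refl g-LP refl (_ , _ , Sf-order) (_ , _ , Sfg-order) j =
  (F-LP , F-length , F-order) , Sym-isSymmetric s-sign (f ∨ G)
  where
  s      = sgn m
  s-sign = sgn-isSign m
  G      = GSeq s g j
  F-LP : IsLP (Sym s (f ∨ G))
  F-LP = ++⁺ fG-LP (IsLP-signedReverse s-sign fG-LP)
    where fG-LP = ++⁺ f-LP (IsLP-GSeq s-sign g g-LP j)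
  double-distrib : ∀ n j d → (n + j * d) + (n + j * d) ≡ 2 * n + 2 * j * d
  double-distrib = ℕ-Solver.solve-∀
  F-length : length (Sym s (f ∨ G)) ≡ 2 * length f + 2 * j * length g
  F-length = begin
    length (Sym s (f ∨ G))                                  ≡⟨ length-Sym s (f ∨ G) ⟩
    length (f ∨ G) + length (f ∨ G)                         ≡⟨ cong (λ k → k + k) (trans (length-++ f) (cong (_+_ (length f)) (length-GSeq s-sign g j))) ⟩
    (length f + j * length g) + (length f + j * length g)   ≡⟨ double-distrib (length f) j (length g) ⟩
    2 * length f + 2 * j * length g                         ∎
  F-order : HasOrder (Sym s (f ∨ G)) m
  F-order = subst (λ h → HasOrder h m) (sym (Sym-∨-GSeq s-sign g f j))
    (∣ₚ-∨^ (x-1^ m) f (period s-sign g) (signedReverse s f) Sf-order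
      (subst (λ h → HasOrder h m) (Sym-∨-GSeq s-sign g f 1) Sfg-order) j)
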